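{- Let $(R_1,R_2,\dots)$ be a Markov splitting process of random ranked plane trees and let $k\ge 1$. Suppose the model is split-exchangeable, i.e. $\Pr\{R_k=r\}=\Pr\{R_k=r'\}$ whenever the ranked plane trees $r,r'$ with $k$ leaves have the same underlying plane tree. Let $\hat T_k$ be the plane tree underlying $R_k$. Then for every plane tree $\hat t$ with $k$ leaves, \[ \Pr\{\hat T_k=\hat t\}=B(\hat t)\times\Pr\{R_k=r\}, \] where $r$ is any ranked plane tree whose underlying plane tree is $\hat t$, and $B(\hat t)=\dfrac{(k-1)!}{\prod_u\lfloor \hat t(u)\rfloor}$ is the Catalan coefficient of $\hat t$, the product running over the internal nodes $u$ of $\hat t$ and $\lfloor \hat t(u)\rfloor$ denoting the number of internal nodes of the subtree of $\hat t$ rooted at $u$.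
   Context: Trees are finite rooted binary trees (each internal node has two children), unlabeled. A plane tree additionally has the two children of each internal node ordered (left/right), identified up to order-preserving isomorphism. A ranked plane tree with $k$ leaves is a plane tree with a bijection from its $k-1$ internal nodes to $\{1,\dots,k-1\}$ such that the root has rank $1$ and ranks strictly increase along paths away from the root; forgetting the ranks gives its underlying plane tree. A Markov splitting process is the following random recursive construction: $R_1$ is the tree consisting of a single (leaf) root node; given $R_i$ (with $i$ leaves), a leaf $\ell$ of $R_i$ is chosen at random with probabilities that depend only on the underlying plane tree of $R_i$ (not on the ranks, i.e. not on the history of splits), and $R_{i+1}$ is obtained by giving $\ell$ rank $i$ and attaching to it a new left child leaf and a new right child leaf. -}

module Defs where

open import Level using (Level)
open import Data.Nat using (ℕ; zero; suc; _+_; _*_; _∸_; _<_; NonZero; _!; _/_)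
open import Data.Nat.Properties using (m*n≢0)
import Data.Nat.Properties as ℕP
open import Data.Fin using (Fin; splitAt)
open import Data.List using (List; []; _∷_; _++_; map; concatMap; filter; foldr; upTo; allFin)
open import Data.List.Relation.Binary.Permutation.Propositional using (_↭_)
open import Data.Product using (_×_; _,_; proj₁; proj₂)
open import Data.Sum using (inj₁; inj₂)
open import Data.Unit using (⊤)
open import Relation.Binary.PropositionalEquality using (_≡_; refl; cong₂)
open import Relation.Nullary using (Dec; yes; no)
open import Relation.Binary using (DecidableEquality)
open import Algebra.Bundles using (CommutativeSemiring)

data PlaneTree : Set where
  leaf : PlaneTree
  node : PlaneTree → PlaneTree → PlaneTree

leaves : PlaneTree → ℕ
leaves leaf       = 1
leaves (node l r) = leaves l + leaves r

internals : PlaneTree → ℕ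
internals leaf       = 0
internals (node l r) = suc (internals l + internals r)

-- ∏_u ⌊t(u)⌋ over internal nodes u, ⌊t(u)⌋ = #internal nodes of subtree at u
catProd : PlaneTree → ℕ
catProd leaf       = 1
catProd (node l r) = (suc (internals l + internals r) * catProd l) * catProd r

catProd-nonZero : (t : PlaneTree) → NonZero (catProd t)
catProd-nonZero leaf = _
catProd-nonZero (node l r) =
  let instance _ = catProd-nonZero l
               _ = catProd-nonZero r
               _ = m*n≢0 (suc (internals l + internals r)) (catProd l)
  in m*n≢0 (suc (internals l + internals r) * catProd l) (catProd r)

-- Catalan coefficient B(t) = (k-1)! / ∏_u ⌊t(u)⌋ (k-1 = internals t);
-- (the division is exact; ℕ-division used)
catalan : PlaneTree → ℕ
catalan t = _/_ (internals t !) (catProd t) {{catProd-nonZero t}}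

data RTree : Set where
  rleaf : RTree
  rnode : ℕ → RTree → RTree → RTree

forget : RTree → PlaneTree
forget rleaf         = leaf
forget (rnode _ a b) = node (forget a) (forget b)

labels : RTree → List ℕ
labels rleaf         = []
labels (rnode n a b) = n ∷ labels a ++ labels b

Above : ℕ → RTree → Set
Above n rleaf         = ⊤
Above n (rnode m _ _) = n < m

Increasing : RTree → Set
Increasing rleaf         = ⊤
Increasing (rnode n a b) = Above n a × Above n b × Increasing a × Increasing b

RootRankOne : RTree → Set
RootRankOne rleaf         = ⊤
RootRankOne (rnode n _ _) = n ≡ 1

IsRanked : ℕ → RTree → Set
IsRanked k r =
  (leaves (forget r) ≡ k) ×
  (labels r ↭ map suc (upTo (k ∸ 1))) ×
  RootRankOne r ×
  Increasing r

_≟T_ : DecidableEquality RTree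
rleaf ≟T rleaf = yes refl
rleaf ≟T rnode _ _ _ = no (λ ())
rnode _ _ _ ≟T rleaf = no (λ ())
rnode n a b ≟T rnode m c d with n ℕP.≟ m | a ≟T c | b ≟T d
... | yes refl | yes refl | yes refl = yes refl
... | no ne | _ | _ = no (λ { refl → ne refl })
... | yes _ | no ne | _ = no (λ { refl → ne refl })
... | yes _ | yes _ | no ne = no (λ { refl → ne refl })

_≟P_ : DecidableEquality PlaneTree
leaf ≟P leaf = yes refl
leaf ≟P node _ _ = no (λ ())
node _ _ ≟P leaf = no (λ ())
node a b ≟P node c d with a ≟P c | b ≟P d
... | yes refl | yes refl = yes refl
... | no ne | _ = no (λ { refl → ne refl })
... | yes _ | no ne = no (λ { refl → ne refl })

-- split the ℓ-th leaf (leaves numbered 0,1,… from left to right),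
-- giving it rank i and two new leaf children
split : (r : RTree) → Fin (leaves (forget r)) → ℕ → RTree
split rleaf         _ i = rnode i rleaf rleaf
split (rnode n a b) ℓ i with splitAt (leaves (forget a)) ℓ
... | inj₁ ℓa = rnode n (split a ℓa i) b
... | inj₂ ℓb = rnode n a (split b ℓb i)

-- Markov splitting process with weights in a commutative semiring.
-- p t ℓ = probability of choosing leaf ℓ of a tree whose underlying
-- plane tree is t (depends only on the underlying plane tree).

module Process {c ℓ′ : Level} (S : CommutativeSemiring c ℓ′)
               (p : (t : PlaneTree) → Fin (leaves t) → CommutativeSemiring.Carrier S) where
  open CommutativeSemiring S using (Carrier; _≈_) renaming (_+_ to _+S_; _*_ to _*S_; 0# to 0S; 1# to 1S)

  sumS : List Carrier → Carrier
  sumS = foldr _+S_ 0S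

  step : ℕ → List (RTree × Carrier) → List (RTree × Carrier)
  step i = concatMap (λ e →
             map (λ ℓ → split (proj₁ e) ℓ i , proj₂ e *S p (forget (proj₁ e)) ℓ)
                 (allFin (leaves (forget (proj₁ e)))))

  -- dist k = law of R_k as a list of (outcome, probability); R_1 = leaf
  dist : ℕ → List (RTree × Carrier)
  dist zero          = []
  dist (suc zero)    = (rleaf , 1S) ∷ []
  dist (suc (suc i)) = step (suc i) (dist (suc i))

  PrR : ℕ → RTree → Carrier
  PrR k r = sumS (map proj₂ (filter (λ e → proj₁ e ≟T r) (dist k)))

  PrT : ℕ → PlaneTree → Carrier
  PrT k t = sumS (map proj₂ (filter (λ e → forget (proj₁ e) ≟P t) (dist k)))

  -- p is a probability distribution on the leaves of each tree
  -- (sums to 1; nonnegativity has no meaning in a general semiring)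
  SumsToOne : Set ℓ′
  SumsToOne = (t : PlaneTree) → sumS (map (p t) (allFin (leaves t))) ≈ 1S

  open import Algebra.Properties.Monoid.Mult (CommutativeSemiring.+-monoid S)
    using () renaming (_×_ to _×ₛ_) public

module Submission where

-- The law of Rₖ is the list  dist k  of (ranked tree, weight) pairs, and the theorem
-- follows from three facts about it.
--   (1) Each listed tree is ranked with k leaves and none is listed twice (a split at a
--       fresh rank is injective and undone by unsplit), so a listed tree r has weight Pr{Rₖ = r}.
--   (2) Exactly B(t) listed trees have shape t.  The shapes reached from s by one split
--       form  splits s;  t occurs there as often as s occurs in  cherries t  (the trees left
--       by removing a cherry of t), so by double counting the shape counts obey the cherry
--       recursion.  So does  rankings t,  by Pascal's rule, and rankings t = B(t).
--   (3) By split-exchangeability all listed trees of shape t have the weight Pr{Rₖ = r}.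

open import Defs
open import Level using (Level)
open import Function using (_∘_)
open import Data.Bool using (if_then_else_; true; false)
open import Data.Nat using (ℕ; zero; suc; _+_; _*_; _∸_; _<_; _≥_; _!; _/_; s≤s; z≤n; NonZero)
open import Data.Nat.Properties
open import Data.Nat.Combinatorics
  using (_C_; nCn≡1; nCk+nC[k+1]≡[n+1]C[k+1]; nCk≡n!/k![n-k]!; k![n∸k]!∣n!)
open import Data.Nat.DivMod using (m*n/n≡m; m/n*n≡m)
open import Data.Nat.Solver using (module +-*-Solver)
open import Algebra.Properties.CommutativeSemigroup +-commutativeSemigroup using (interchange)
open import Data.Fin using (Fin; splitAt; _↑ˡ_; _↑ʳ_) renaming (zero to fzero; suc to fsuc)
open import Data.Fin.Properties using (splitAt-↑ˡ; splitAt-↑ʳ; splitAt⁻¹-↑ˡ; splitAt⁻¹-↑ʳ)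
open import Data.List using (List; []; _∷_; _++_; map; tabulate; allFin; filter; length; upTo)
open import Data.List.Properties using (map-++; map-∘; map-tabulate; tabulate-cong; ++-identityʳ; upTo-∷ʳ)
open import Data.List.Relation.Unary.All as All using (All; []; _∷_)
import Data.List.Relation.Unary.All.Properties as AllP
open import Data.List.Relation.Unary.Any using (here; there)
open import Data.List.Relation.Unary.AllPairs using ([]; _∷_)
open import Data.List.Relation.Unary.Unique.Propositional using (Unique)
import Data.List.Relation.Unary.Unique.Propositional.Properties as UniqueP
open import Data.List.Membership.Propositional using (_∈_)
open import Data.List.Relation.Binary.Permutation.Propositional
  using (_↭_; ↭-refl; ↭-prep; ↭-swap; ↭-trans; ↭-sym; ↭-reflexive)
open import Data.List.Relation.Binary.Permutation.Propositional.Properties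
  using (++⁺ˡ; ++⁺ʳ; shift; ∷↭∷ʳ; All-resp-↭)
open import Data.Product using (_×_; _,_; proj₁; proj₂)
open import Data.Sum using (inj₁; inj₂)
open import Data.Unit using (tt)
open import Data.Empty using (⊥-elim)
open import Relation.Nullary using (Dec; yes; no; does; ¬_; _×-dec_)
open import Relation.Binary.PropositionalEquality
open import Algebra.Bundles using (CommutativeSemiring)
import Relation.Binary.Reasoning.Setoid as SetoidReasoning

private
  variable
    a b : Level
    A : Set a
    B : Set b

∑ : (A → ℕ) → List A → ℕ
∑ f []       = 0
∑ f (x ∷ xs) = f x + ∑ f xs

∑-++ : (f : A → ℕ) (xs ys : List A) → ∑ f (xs ++ ys) ≡ ∑ f xs + ∑ f ys
∑-++ f []       ys = refl
∑-++ f (x ∷ xs) ys = trans (cong (f x +_) (∑-++ f xs ys)) (sym (+-assoc (f x) _ _))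

∑-map : (f : B → ℕ) (g : A → B) (xs : List A) → ∑ f (map g xs) ≡ ∑ (f ∘ g) xs
∑-map f g []       = refl
∑-map f g (x ∷ xs) = cong (f (g x) +_) (∑-map f g xs)

∑-cong-All : {f g : A → ℕ} (xs : List A) → All (λ x → f x ≡ g x) xs → ∑ f xs ≡ ∑ g xs
∑-cong-All []       []          = refl
∑-cong-All (x ∷ xs) (fx≡gx ∷ h) = cong₂ _+_ fx≡gx (∑-cong-All xs h)

∑-cong : {f g : A → ℕ} (xs : List A) → (∀ x → f x ≡ g x) → ∑ f xs ≡ ∑ g xs
∑-cong xs f≗g = ∑-cong-All xs (All.universal f≗g xs)

∑-*ˡ : (c : ℕ) (f : A → ℕ) (xs : List A) → ∑ (λ x → c * f x) xs ≡ c * ∑ f xs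
∑-*ˡ c f []       = sym (*-zeroʳ c)
∑-*ˡ c f (x ∷ xs) = trans (cong (c * f x +_) (∑-*ˡ c f xs)) (sym (*-distribˡ-+ c (f x) _))

∑-*ʳ : (c : ℕ) (f : A → ℕ) (xs : List A) → ∑ (λ x → f x * c) xs ≡ ∑ f xs * c
∑-*ʳ c f []       = refl
∑-*ʳ c f (x ∷ xs) = trans (cong (f x * c +_) (∑-*ʳ c f xs)) (sym (*-distribʳ-+ c (f x) _))

∑-+ : (f g : A → ℕ) (xs : List A) → ∑ (λ x → f x + g x) xs ≡ ∑ f xs + ∑ g xs
∑-+ f g []       = refl
∑-+ f g (x ∷ xs) =
  trans (cong (f x + g x +_) (∑-+ f g xs)) (interchange (f x) (g x) (∑ f xs) (∑ g xs))

∑-zero : (xs : List A) → ∑ (λ _ → 0) xs ≡ 0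
∑-zero []       = refl
∑-zero (_ ∷ xs) = ∑-zero xs

∑-comm : (h : A → B → ℕ) (xs : List A) (ys : List B) →
         ∑ (λ x → ∑ (h x) ys) xs ≡ ∑ (λ y → ∑ (λ x → h x y) xs) ys
∑-comm h []       ys = sym (∑-zero ys)
∑-comm h (x ∷ xs) ys =
  trans (cong (∑ (h x) ys +_) (∑-comm h xs ys)) (sym (∑-+ (h x) _ ys))

⟦_⟧ : ∀ {p} {P : Set p} → Dec P → ℕ
⟦ d ⟧ = if does d then 1 else 0

⟦⟧-cong : ∀ {p q} {P : Set p} {Q : Set q} → (P → Q) → (Q → P) →
          (d : Dec P) (e : Dec Q) → ⟦ d ⟧ ≡ ⟦ e ⟧
⟦⟧-cong P→Q Q→P (yes _)  (yes _)  = refl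
⟦⟧-cong P→Q Q→P (no _)   (no _)   = refl
⟦⟧-cong P→Q Q→P (yes p)  (no ¬q)  = ⊥-elim (¬q (P→Q p))
⟦⟧-cong P→Q Q→P (no ¬p)  (yes q)  = ⊥-elim (¬p (Q→P q))

⟦⟧-× : ∀ {p q} {P : Set p} {Q : Set q} (d : Dec P) (e : Dec Q) →
       ⟦ d ×-dec e ⟧ ≡ ⟦ d ⟧ * ⟦ e ⟧
⟦⟧-× (yes _) (yes _) = refl
⟦⟧-× (yes _) (no _)  = refl
⟦⟧-× (no _)  _       = refl

δ : PlaneTree → PlaneTree → ℕ
δ s t = ⟦ s ≟P t ⟧

δ-sym : (s t : PlaneTree) → δ s t ≡ δ t s
δ-sym s t = ⟦⟧-cong sym sym (s ≟P t) (t ≟P s)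

δ-node : (x y u v : PlaneTree) → δ (node x y) (node u v) ≡ δ x u * δ y v
δ-node x y u v =
  trans (⟦⟧-cong (λ { refl → refl , refl }) (λ { (refl , refl) → refl })
                 (node x y ≟P node u v) (x ≟P u ×-dec y ≟P v))
        (⟦⟧-× (x ≟P u) (y ≟P v))

mult : PlaneTree → List PlaneTree → ℕ
mult t = ∑ (λ x → δ x t)

mult-nodeˡ : (l r b : PlaneTree) (xs : List PlaneTree) →
             mult (node l r) (map (λ x → node x b) xs) ≡ mult l xs * δ b r
mult-nodeˡ l r b xs = begin
  mult (node l r) (map (λ x → node x b) xs) ≡⟨ ∑-map _ _ xs ⟩
  ∑ (λ x → δ (node x b) (node l r)) xs      ≡⟨ ∑-cong xs (λ x → δ-node x b l r) ⟩
  ∑ (λ x → δ x l * δ b r) xs                ≡⟨ ∑-*ʳ (δ b r) (λ x → δ x l) xs ⟩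
  mult l xs * δ b r                         ∎
  where open ≡-Reasoning

mult-nodeʳ : (l r a : PlaneTree) (ys : List PlaneTree) →
             mult (node l r) (map (node a) ys) ≡ δ a l * mult r ys
mult-nodeʳ l r a ys = begin
  mult (node l r) (map (node a) ys) ≡⟨ ∑-map _ _ ys ⟩
  ∑ (λ y → δ (node a y) (node l r)) ys ≡⟨ ∑-cong ys (λ y → δ-node a y l r) ⟩
  ∑ (λ y → δ a l * δ y r) ys           ≡⟨ ∑-*ˡ (δ a l) (λ y → δ y r) ys ⟩
  δ a l * mult r ys                    ∎
  where open ≡-Reasoning

mult-leafˡ : (b : PlaneTree) (xs : List PlaneTree) → mult leaf (map (λ x → node x b) xs) ≡ 0
mult-leafˡ b xs = trans (∑-map _ _ xs) (∑-zero xs)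

mult-leafʳ : (a : PlaneTree) (ys : List PlaneTree) → mult leaf (map (node a) ys) ≡ 0
mult-leafʳ a ys = trans (∑-map _ _ ys) (∑-zero ys)

mult-swap : (f : A → PlaneTree) (xs : List A) (ys : List PlaneTree) →
            ∑ (λ x → mult (f x) ys) xs ≡ ∑ (λ y → mult y (map f xs)) ys
mult-swap f xs ys = begin
  ∑ (λ x → ∑ (λ y → δ y (f x)) ys) xs ≡⟨ ∑-comm _ xs ys ⟩
  ∑ (λ y → ∑ (λ x → δ y (f x)) xs) ys
    ≡⟨ ∑-cong ys (λ y → ∑-cong xs (λ x → δ-sym y (f x))) ⟩
  ∑ (λ y → ∑ (λ x → δ (f x) y) xs) ys ≡⟨ ∑-cong ys (λ y → sym (∑-map _ f xs)) ⟩
  ∑ (λ y → mult y (map f xs)) ys      ∎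
  where open ≡-Reasoning

length-filter : ∀ {p} {P : A → Set p} (P? : (x : A) → Dec (P x)) (xs : List A) →
                length (filter P? xs) ≡ ∑ (λ x → ⟦ P? x ⟧) xs
length-filter P? []       = refl
length-filter P? (x ∷ xs) with does (P? x)
... | true  = cong suc (length-filter P? xs)
... | false = length-filter P? xs

-- Plane trees: splitting a leaf and removing a cherry

leaves≡suc-internals : (t : PlaneTree) → leaves t ≡ suc (internals t)
leaves≡suc-internals leaf       = refl
leaves≡suc-internals (node l r) =
  trans (cong₂ _+_ (leaves≡suc-internals l) (leaves≡suc-internals r))
        (cong suc (+-suc (internals l) (internals r)))

splits : PlaneTree → List PlaneTree
splits leaf       = node leaf leaf ∷ []
splits (node a b) = map (λ x → node x b) (splits a) ++ map (node a) (splits b)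

rootCherry : PlaneTree → PlaneTree → List PlaneTree
rootCherry leaf       leaf       = leaf ∷ []
rootCherry leaf       (node _ _) = []
rootCherry (node _ _) _          = []

cherries : PlaneTree → List PlaneTree
cherriesBelow : PlaneTree → PlaneTree → List PlaneTree

cherries leaf       = []
cherries (node l r) = rootCherry l r ++ cherriesBelow l r

cherriesBelow l r = map (λ x → node x r) (cherries l) ++ map (node l) (cherries r)

cherries-internals : (t : PlaneTree) → All (λ x → suc (internals x) ≡ internals t) (cherries t)
cherries-internals leaf       = []
cherries-internals (node l r) =
  AllP.++⁺ (root l r)
    (AllP.++⁺ (AllP.map⁺ (All.map (cong (λ z → suc (z + internals r))) (cherries-internals l)))
              (AllP.map⁺ (All.map (λ {y} eq → cong suc (trans (sym (+-suc (internals l) (internals y)))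
                                                              (cong (internals l +_) eq)))
                                  (cherries-internals r))))
  where
  root : (l r : PlaneTree) → All (λ x → suc (internals x) ≡ internals (node l r)) (rootCherry l r)
  root leaf       leaf       = refl ∷ []
  root leaf       (node _ _) = []
  root (node _ _) _          = []

splits-cherries : (s t : PlaneTree) → mult t (splits s) ≡ mult s (cherries t)
splits-cherries leaf       leaf       = refl
splits-cherries leaf       (node l r) = begin
  mult (node l r) (splits leaf)
    ≡⟨ rootCherry-leaf l r ⟩
  mult leaf (rootCherry l r)
    ≡⟨ +-identityʳ _ ⟨
  mult leaf (rootCherry l r) + 0
    ≡⟨ cong (mult leaf (rootCherry l r) +_) no-deeper-leaf ⟨
  mult leaf (rootCherry l r) + mult leaf (cherriesBelow l r)
    ≡⟨ ∑-++ _ (rootCherry l r) (cherriesBelow l r) ⟨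
  mult leaf (cherries (node l r)) ∎
  where
  open ≡-Reasoning
  -- only the root can leave a leaf behind, namely when it is a cherry
  rootCherry-leaf : (l r : PlaneTree) → mult (node l r) (splits leaf) ≡ mult leaf (rootCherry l r)
  rootCherry-leaf leaf       leaf       = refl
  rootCherry-leaf leaf       (node _ _) = refl
  rootCherry-leaf (node _ _) _          = refl
  no-deeper-leaf : mult leaf (cherriesBelow l r) ≡ 0
  no-deeper-leaf = trans (∑-++ _ (map (λ x → node x r) (cherries l)) _)
                         (cong₂ _+_ (mult-leafˡ r (cherries l)) (mult-leafʳ l (cherries r)))
splits-cherries (node a b) leaf       =
  trans (∑-++ _ (map (λ x → node x b) (splits a)) _)
        (cong₂ _+_ (mult-leafˡ b (splits a)) (mult-leafʳ a (splits b)))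
splits-cherries (node a b) (node l r) = begin
  mult (node l r) (map (λ x → node x b) (splits a) ++ map (node a) (splits b))
    ≡⟨ ∑-++ _ (map (λ x → node x b) (splits a)) _ ⟩
  mult (node l r) (map (λ x → node x b) (splits a)) + mult (node l r) (map (node a) (splits b))
    ≡⟨ cong₂ _+_ (mult-nodeˡ l r b (splits a)) (mult-nodeʳ l r a (splits b)) ⟩
  mult l (splits a) * δ b r + δ a l * mult r (splits b)
    ≡⟨ cong₂ _+_ (cong₂ _*_ (splits-cherries a l) (δ-sym b r))
                 (cong₂ _*_ (δ-sym a l) (splits-cherries b r)) ⟩
  mult a (cherries l) * δ r b + δ l a * mult b (cherries r)
    ≡⟨ sym (cong₂ _+_ (mult-nodeˡ a b r (cherries l)) (mult-nodeʳ a b l (cherries r))) ⟩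
  mult (node a b) (map (λ x → node x r) (cherries l)) + mult (node a b) (map (node l) (cherries r))
    ≡⟨ sym (∑-++ _ (map (λ x → node x r) (cherries l)) _) ⟩
  mult (node a b) (cherriesBelow l r)
    ≡⟨ cong (_+ mult (node a b) (cherriesBelow l r)) (rootCherry-node l r) ⟨
  mult (node a b) (rootCherry l r) + mult (node a b) (cherriesBelow l r)
    ≡⟨ ∑-++ _ (rootCherry l r) (cherriesBelow l r) ⟨
  mult (node a b) (cherries (node l r)) ∎
  where
  open ≡-Reasoning
  rootCherry-node : (l r : PlaneTree) → mult (node a b) (rootCherry l r) ≡ 0
  rootCherry-node leaf       leaf       = refl
  rootCherry-node leaf       (node _ _) = refl
  rootCherry-node (node _ _) _          = refl

-- Rankings of a plane tree and the Catalan coefficient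

-- rankings t counts the rankings of the internal nodes of t: below the root, the
-- rankings of the two subtrees are interleaved in any of the binomially many ways.
rankings : PlaneTree → ℕ
rankings leaf       = 1
rankings (node l r) = ((internals l + internals r) C internals l) * rankings l * rankings r

∑-rankings-nodeˡ : (c : ℕ) (r : PlaneTree) (xs : List PlaneTree) →
                   All (λ x → internals x ≡ c) xs →
                   ∑ rankings (map (λ x → node x r) xs)
                     ≡ ((c + internals r) C c) * ∑ rankings xs * rankings r
∑-rankings-nodeˡ c r xs sizes = begin
  ∑ rankings (map (λ x → node x r) xs)
    ≡⟨ ∑-map rankings _ xs ⟩
  ∑ (λ x → ((internals x + internals r) C internals x) * rankings x * rankings r) xs
    ≡⟨ ∑-cong-All xs (All.map (λ {x} → cong (λ z → ((z + internals r) C z) * rankings x * rankings r))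
                              sizes) ⟩
  ∑ (λ x → binomial * rankings x * rankings r) xs
    ≡⟨ ∑-*ʳ (rankings r) (λ x → binomial * rankings x) xs ⟩
  ∑ (λ x → binomial * rankings x) xs * rankings r
    ≡⟨ cong (_* rankings r) (∑-*ˡ binomial rankings xs) ⟩
  binomial * ∑ rankings xs * rankings r ∎
  where
  open ≡-Reasoning
  binomial = (c + internals r) C c

∑-rankings-nodeʳ : (c : ℕ) (l : PlaneTree) (ys : List PlaneTree) →
                   All (λ y → internals y ≡ c) ys →
                   ∑ rankings (map (node l) ys)
                     ≡ ((internals l + c) C internals l) * rankings l * ∑ rankings ys
∑-rankings-nodeʳ c l ys sizes = begin
  ∑ rankings (map (node l) ys)
    ≡⟨ ∑-map rankings _ ys ⟩
  ∑ (λ y → ((internals l + internals y) C internals l) * rankings l * rankings y) ys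
    ≡⟨ ∑-cong-All ys (All.map (λ {y} → cong (λ z → ((internals l + z) C internals l)
                                                   * rankings l * rankings y))
                              sizes) ⟩
  ∑ (λ y → binomial * rankings l * rankings y) ys
    ≡⟨ ∑-*ˡ (binomial * rankings l) rankings ys ⟩
  binomial * rankings l * ∑ rankings ys ∎
  where
  open ≡-Reasoning
  binomial = (internals l + c) C internals l

cherries-internals-node : (l r : PlaneTree) →
                          All (λ x → internals x ≡ internals l + internals r) (cherries (node l r))
cherries-internals-node l r = All.map suc-injective (cherries-internals (node l r))

[n+0]Cn≡1 : (n : ℕ) → (n + 0) C n ≡ 1
[n+0]Cn≡1 n = trans (cong (_C n) (+-identityʳ n)) (nCn≡1 n)

-- The number of rankings satisfies the cherry recursion: ranking t is the same as
-- choosing the cherry that carries the largest rank, then ranking what remains.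
rankings-cherries : (l r : PlaneTree) → ∑ rankings (cherries (node l r)) ≡ rankings (node l r)
rankings-cherries leaf leaf = refl
rankings-cherries leaf r@(node r₁ r₂) =   -- here both binomials are (_ C 0), which is 1
  trans (∑-rankings-nodeʳ _ leaf (cherries r) (cherries-internals-node r₁ r₂))
        (cong (λ z → 1 * 1 * z) (rankings-cherries r₁ r₂))
rankings-cherries l@(node l₁ l₂) leaf = begin
  ∑ rankings (map (λ x → node x leaf) (cherries l) ++ [])
    ≡⟨ cong (∑ rankings) (++-identityʳ (map (λ x → node x leaf) (cherries l))) ⟩
  ∑ rankings (map (λ x → node x leaf) (cherries l))
    ≡⟨ ∑-rankings-nodeˡ m leaf (cherries l) (cherries-internals-node l₁ l₂) ⟩
  ((m + 0) C m) * ∑ rankings (cherries l) * 1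
    ≡⟨ cong₂ (λ x y → x * y * 1) ([n+0]Cn≡1 m) (rankings-cherries l₁ l₂) ⟩
  1 * rankings l * 1
    ≡⟨ cong (λ x → x * rankings l * 1) ([n+0]Cn≡1 (suc m)) ⟨
  rankings (node l leaf) ∎
  where
  open ≡-Reasoning
  m = internals l₁ + internals l₂
rankings-cherries l@(node l₁ l₂) r@(node r₁ r₂) = begin
  ∑ rankings (cherriesBelow l r)
    ≡⟨ ∑-++ rankings (map (λ x → node x r) (cherries l)) _ ⟩
  ∑ rankings (map (λ x → node x r) (cherries l)) + ∑ rankings (map (node l) (cherries r))
    ≡⟨ cong₂ _+_ (∑-rankings-nodeˡ m r (cherries l) (cherries-internals-node l₁ l₂))
                 (∑-rankings-nodeʳ n l (cherries r) (cherries-internals-node r₁ r₂)) ⟩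
  ((m + suc n) C m) * ∑ rankings (cherries l) * rankings r
    + ((suc m + n) C suc m) * rankings l * ∑ rankings (cherries r)
    ≡⟨ cong₂ (λ x y → ((m + suc n) C m) * x * rankings r + ((suc m + n) C suc m) * rankings l * y)
             (rankings-cherries l₁ l₂) (rankings-cherries r₁ r₂) ⟩
  ((m + suc n) C m) * rankings l * rankings r + ((suc m + n) C suc m) * rankings l * rankings r
    ≡⟨ cong (λ z → ((m + suc n) C m) * rankings l * rankings r + (z C suc m) * rankings l * rankings r)
            (+-suc m n) ⟨
  ((m + suc n) C m) * rankings l * rankings r + ((m + suc n) C suc m) * rankings l * rankings r
    ≡⟨ factor ((m + suc n) C m) ((m + suc n) C suc m) (rankings l) (rankings r) ⟩
  ((m + suc n) C m + (m + suc n) C suc m) * rankings l * rankings r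
    ≡⟨ cong (λ z → z * rankings l * rankings r) (nCk+nC[k+1]≡[n+1]C[k+1] (m + suc n) m) ⟩
  rankings (node l r) ∎
  where
  open ≡-Reasoning
  m = internals l₁ + internals l₂
  n = internals r₁ + internals r₂
  factor : (x y u v : ℕ) → x * u * v + y * u * v ≡ (x + y) * u * v
  factor x y u v = sym (trans (cong (_* v) (*-distribʳ-+ u x y)) (*-distribʳ-+ v (x * u) (y * u)))

binomial-factorials : (m n : ℕ) → ((m + n) C m) * (m ! * n !) ≡ (m + n) !
binomial-factorials m n = begin
  ((m + n) C m) * (m ! * n !)
    ≡⟨ cong (λ z → ((m + n) C m) * (m ! * z !)) (m+n∸m≡n m n) ⟨
  ((m + n) C m) * (m ! * (m + n ∸ m) !)
    ≡⟨ cong (_* (m ! * (m + n ∸ m) !)) (nCk≡n!/k![n-k]! (m≤m+n m n)) ⟩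
  ((m + n) ! / (m ! * (m + n ∸ m) !)) * (m ! * (m + n ∸ m) !)
    ≡⟨ m/n*n≡m (k![n∸k]!∣n! (m≤m+n m n)) ⟩
  (m + n) ! ∎
  where
  open ≡-Reasoning
  instance
    factorials≢0 : NonZero (m ! * (m + n ∸ m) !)
    factorials≢0 = m*n≢0 (m !) ((m + n ∸ m) !) ⦃ m !≢0 ⦄ ⦃ (m + n ∸ m) !≢0 ⦄

-- rankings t · ∏_u ⌊t(u)⌋ = (number of internal nodes of t)!  (the hook length formula for trees).
rankings*catProd : (t : PlaneTree) → rankings t * catProd t ≡ internals t !
rankings*catProd leaf       = refl
rankings*catProd (node l r) = begin
  ((m + n) C m) * rankings l * rankings r * (suc (m + n) * catProd l * catProd r)
    ≡⟨ rearrange (m + n) ((m + n) C m) (rankings l) (rankings r) (catProd l) (catProd r) ⟩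
  suc (m + n) * (((m + n) C m) * (rankings l * catProd l * (rankings r * catProd r)))
    ≡⟨ cong (λ z → suc (m + n) * (((m + n) C m) * z))
            (cong₂ _*_ (rankings*catProd l) (rankings*catProd r)) ⟩
  suc (m + n) * (((m + n) C m) * (m ! * n !))
    ≡⟨ cong (suc (m + n) *_) (binomial-factorials m n) ⟩
  suc (m + n) ! ∎
  where
  open ≡-Reasoning
  open +-*-Solver
  m = internals l
  n = internals r
  rearrange : (k c x y u v : ℕ) → c * x * y * (suc k * u * v) ≡ suc k * (c * (x * u * (y * v)))
  rearrange = solve 6 (λ k c x y u v → c :* x :* y :* ((con 1 :+ k) :* u :* v)
                                     := (con 1 :+ k) :* (c :* (x :* u :* (y :* v)))) refl

catalan≡rankings : (t : PlaneTree) → catalan t ≡ rankings t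
catalan≡rankings t = begin
  (internals t ! / catProd t) ⦃ catProd-nonZero t ⦄
    ≡⟨ cong (λ z → (z / catProd t) ⦃ catProd-nonZero t ⦄) (rankings*catProd t) ⟨
  (rankings t * catProd t / catProd t) ⦃ catProd-nonZero t ⦄
    ≡⟨ m*n/n≡m (rankings t) (catProd t) ⦃ catProd-nonZero t ⦄ ⟩
  rankings t ∎
  where open ≡-Reasoning

-- Splitting a leaf of a ranked tree

split-↑ˡ : (n : ℕ) (a b : RTree) (x : Fin (leaves (forget a))) (i : ℕ) →
           split (rnode n a b) (x ↑ˡ leaves (forget b)) i ≡ rnode n (split a x i) b
split-↑ˡ n a b x i rewrite splitAt-↑ˡ (leaves (forget a)) x (leaves (forget b)) = refl

split-↑ʳ : (n : ℕ) (a b : RTree) (y : Fin (leaves (forget b))) (i : ℕ) →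
           split (rnode n a b) (leaves (forget a) ↑ʳ y) i ≡ rnode n a (split b y i)
split-↑ʳ n a b y i rewrite splitAt-↑ʳ (leaves (forget a)) (leaves (forget b)) y = refl

tabulate-+ : (m : ℕ) {n : ℕ} (f : Fin (m + n) → A) →
             tabulate f ≡ tabulate (f ∘ (_↑ˡ n)) ++ tabulate (f ∘ (m ↑ʳ_))
tabulate-+ zero    f = refl
tabulate-+ (suc m) f = cong (f fzero ∷_) (tabulate-+ m (f ∘ fsuc))

shape-splits : (r : RTree) (i : ℕ) → tabulate (λ ℓ → forget (split r ℓ i)) ≡ splits (forget r)
shape-splits rleaf         i = refl
shape-splits (rnode n a b) i = begin
  tabulate (λ ℓ → forget (split (rnode n a b) ℓ i))
    ≡⟨ tabulate-+ (leaves (forget a)) (λ ℓ → forget (split (rnode n a b) ℓ i)) ⟩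
  tabulate (λ x → forget (split (rnode n a b) (x ↑ˡ leaves (forget b)) i))
    ++ tabulate (λ y → forget (split (rnode n a b) (leaves (forget a) ↑ʳ y) i))
    ≡⟨ cong₂ _++_ (tabulate-cong (λ x → cong forget (split-↑ˡ n a b x i)))
                  (tabulate-cong (λ y → cong forget (split-↑ʳ n a b y i))) ⟩
  tabulate (λ x → node (forget (split a x i)) (forget b))
    ++ tabulate (λ y → node (forget a) (forget (split b y i)))
    ≡⟨ cong₂ _++_ (map-tabulate (λ x → forget (split a x i)) (λ x → node x (forget b)))
                  (map-tabulate (λ y → forget (split b y i)) (node (forget a))) ⟨
  map (λ x → node x (forget b)) (tabulate (λ x → forget (split a x i)))
    ++ map (node (forget a)) (tabulate (λ y → forget (split b y i)))
    ≡⟨ cong₂ _++_ (cong (map (λ x → node x (forget b))) (shape-splits a i))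
                  (cong (map (node (forget a))) (shape-splits b i)) ⟩
  splits (forget (rnode n a b)) ∎
  where open ≡-Reasoning

leaves-split : (r : RTree) (ℓ : Fin (leaves (forget r))) (i : ℕ) →
               leaves (forget (split r ℓ i)) ≡ suc (leaves (forget r))
leaves-split rleaf         ℓ i = refl
leaves-split (rnode n a b) ℓ i with splitAt (leaves (forget a)) ℓ
... | inj₁ x = cong (_+ leaves (forget b)) (leaves-split a x i)
... | inj₂ y = trans (cong (leaves (forget a) +_) (leaves-split b y i))
                     (+-suc (leaves (forget a)) (leaves (forget b)))

labels-split : (r : RTree) (ℓ : Fin (leaves (forget r))) (i : ℕ) →
               labels (split r ℓ i) ↭ i ∷ labels r
labels-split rleaf         ℓ i = ↭-refl
labels-split (rnode n a b) ℓ i with splitAt (leaves (forget a)) ℓ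
... | inj₁ x = ↭-trans (↭-prep n (++⁺ʳ (labels b) (labels-split a x i))) (↭-swap n i ↭-refl)
... | inj₂ y = ↭-trans (↭-prep n (↭-trans (++⁺ˡ (labels a) (labels-split b y i))
                                          (shift i (labels a) (labels b))))
                       (↭-swap n i ↭-refl)

above-split : (n : ℕ) (r : RTree) (ℓ : Fin (leaves (forget r))) (i : ℕ) →
              Above n r → n < i → Above n (split r ℓ i)
above-split n rleaf         ℓ i _      n<i = n<i
above-split n (rnode m a b) ℓ i n<m _ with splitAt (leaves (forget a)) ℓ
... | inj₁ _ = n<m
... | inj₂ _ = n<m

increasing-split : (r : RTree) (ℓ : Fin (leaves (forget r))) (i : ℕ) →
                   Increasing r → All (_< i) (labels r) → Increasing (split r ℓ i)
increasing-split rleaf         ℓ i _ _ = tt , tt , tt , tt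
increasing-split (rnode n a b) ℓ i (n<a , n<b , inc-a , inc-b) (n<i ∷ below)
  with splitAt (leaves (forget a)) ℓ
... | inj₁ x = above-split n a x i n<a n<i , n<b ,
               increasing-split a x i inc-a (AllP.++⁻ˡ (labels a) below) , inc-b
... | inj₂ y = n<a , above-split n b y i n<b n<i ,
               inc-a , increasing-split b y i inc-b (AllP.++⁻ʳ (labels a) below)

root-split : (r : RTree) (ℓ : Fin (leaves (forget r))) (i : ℕ) →
             RootRankOne r → (r ≡ rleaf → i ≡ 1) → RootRankOne (split r ℓ i)
root-split rleaf         ℓ i _   i≡1 = i≡1 refl
root-split (rnode n a b) ℓ i n≡1 _ with splitAt (leaves (forget a)) ℓ
... | inj₁ _ = n≡1
... | inj₂ _ = n≡1

-- A ranked tree with k leaves all of whose ranks lie below k, so that k is a fresh rank.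
WellRanked : ℕ → RTree → Set
WellRanked k r = IsRanked k r × All (_< k) (labels r)

split-wellRanked : (k : ℕ) (r : RTree) (ℓ : Fin (leaves (forget r))) →
                   WellRanked (suc k) r → WellRanked (suc (suc k)) (split r ℓ (suc k))
split-wellRanked k r ℓ ((leaves≡ , ranks , root , increasing) , below) =
  ( trans (leaves-split r ℓ (suc k)) (cong suc leaves≡)
  , ↭-trans (labels-split r ℓ (suc k)) (↭-trans (↭-prep (suc k) ranks) next-ranks)
  , root-split r ℓ (suc k) root (λ { refl → cong suc (sym (suc-injective leaves≡)) })
  , increasing-split r ℓ (suc k) increasing below )
  , All-resp-↭ (↭-sym (labels-split r ℓ (suc k))) (≤-refl ∷ All.map m<n⇒m<1+n below)
  where
  next-ranks : suc k ∷ map suc (upTo k) ↭ map suc (upTo (suc k))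
  next-ranks = ↭-trans (∷↭∷ʳ (suc k) (map suc (upTo k)))
                       (↭-reflexive (trans (sym (map-++ suc (upTo k) (k ∷ [])))
                                           (cong (map suc) (upTo-∷ʳ k))))

unsplit : ℕ → RTree → RTree
unsplit i rleaf         = rleaf
unsplit i (rnode n a b) with n ≟ i
... | yes _ = rleaf
... | no _  = rnode n (unsplit i a) (unsplit i b)

unsplit-node : (i n : ℕ) (a b : RTree) → n < i →
               unsplit i (rnode n a b) ≡ rnode n (unsplit i a) (unsplit i b)
unsplit-node i n a b n<i with n ≟ i
... | yes refl = ⊥-elim (<-irrefl refl n<i)
... | no _     = refl

unsplit-fresh : (i : ℕ) (r : RTree) → All (_< i) (labels r) → unsplit i r ≡ r
unsplit-fresh i rleaf         _             = refl
unsplit-fresh i (rnode n a b) (n<i ∷ below) =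
  trans (unsplit-node i n a b n<i)
        (cong₂ (rnode n) (unsplit-fresh i a (AllP.++⁻ˡ (labels a) below))
                         (unsplit-fresh i b (AllP.++⁻ʳ (labels a) below)))

unsplit-split : (r : RTree) (ℓ : Fin (leaves (forget r))) (i : ℕ) →
                All (_< i) (labels r) → unsplit i (split r ℓ i) ≡ r
unsplit-split rleaf ℓ i _ with i ≟ i
... | yes _  = refl
... | no i≢i = ⊥-elim (i≢i refl)
unsplit-split (rnode n a b) ℓ i (n<i ∷ below) with splitAt (leaves (forget a)) ℓ
... | inj₁ x = trans (unsplit-node i n (split a x i) b n<i)
                     (cong₂ (rnode n) (unsplit-split a x i (AllP.++⁻ˡ (labels a) below))
                                      (unsplit-fresh i b (AllP.++⁻ʳ (labels a) below)))
... | inj₂ y = trans (unsplit-node i n a (split b y i) n<i)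
                     (cong₂ (rnode n) (unsplit-fresh i a (AllP.++⁻ˡ (labels a) below))
                                      (unsplit-split b y i (AllP.++⁻ʳ (labels a) below)))

split≢ : (r : RTree) (ℓ : Fin (leaves (forget r))) (i : ℕ) → split r ℓ i ≢ r
split≢ r ℓ i eq = <-irrefl (trans (sym (cong (leaves ∘ forget) eq)) (leaves-split r ℓ i))
                           (n<1+n (leaves (forget r)))

leftChild rightChild : RTree → RTree
leftChild rleaf         = rleaf
leftChild (rnode _ a _) = a
rightChild rleaf         = rleaf
rightChild (rnode _ _ b) = b

split-injective : (r : RTree) (i : ℕ) {ℓ ℓ′ : Fin (leaves (forget r))} →
                  split r ℓ i ≡ split r ℓ′ i → ℓ ≡ ℓ′
split-injective rleaf i {fzero} {fzero} _ = refl
split-injective (rnode n a b) i {ℓ} {ℓ′} eq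
  with splitAt (leaves (forget a)) ℓ in at-ℓ | splitAt (leaves (forget a)) ℓ′ in at-ℓ′
... | inj₁ x | inj₁ y = trans (sym (splitAt⁻¹-↑ˡ at-ℓ))
                              (trans (cong (_↑ˡ _) (split-injective a i (cong leftChild eq)))
                                     (splitAt⁻¹-↑ˡ at-ℓ′))
... | inj₂ x | inj₂ y = trans (sym (splitAt⁻¹-↑ʳ at-ℓ))
                              (trans (cong (_ ↑ʳ_) (split-injective b i (cong rightChild eq)))
                                     (splitAt⁻¹-↑ʳ at-ℓ′))
... | inj₁ x | inj₂ y = ⊥-elim (split≢ a x i (cong leftChild eq))
... | inj₂ x | inj₁ y = ⊥-elim (split≢ b x i (cong rightChild eq))

-- The splitting process

module SplittingProcess {c ℓ′ : Level} (S : CommutativeSemiring c ℓ′)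
                        (p : (t : PlaneTree) → Fin (leaves t) → CommutativeSemiring.Carrier S) where

  open Process S p
  open CommutativeSemiring S
    using (Carrier; _≈_; 0#)
    renaming ( _*_ to _*S_; +-cong to +S-cong; +-identityʳ to +S-identityʳ
             ; refl to ≈-refl; sym to ≈-sym; trans to ≈-trans; reflexive to ≈-reflexive )

  Outcome : Set c
  Outcome = RTree × Carrier

  shape : Outcome → PlaneTree
  shape = forget ∘ proj₁

  children : ℕ → Outcome → List Outcome
  children i (r , w) = map (λ ℓ → split r ℓ i , w *S p (forget r) ℓ) (allFin (leaves (forget r)))

  children-trees : (i : ℕ) (e : Outcome) →
                   map proj₁ (children i e) ≡ tabulate (λ ℓ → split (proj₁ e) ℓ i)
  children-trees i (r , w) =
    trans (cong (map proj₁) (map-tabulate (λ ℓ → ℓ) child)) (map-tabulate child proj₁)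
    where
    child = λ ℓ → split r ℓ i , w *S p (forget r) ℓ

  children-shapes : (i : ℕ) (e : Outcome) → map shape (children i e) ≡ splits (shape e)
  children-shapes i e = begin
    map shape (children i e)                          ≡⟨ map-∘ (children i e) ⟩
    map forget (map proj₁ (children i e))             ≡⟨ cong (map forget) (children-trees i e) ⟩
    map forget (tabulate (λ ℓ → split (proj₁ e) ℓ i)) ≡⟨ map-tabulate _ forget ⟩
    tabulate (λ ℓ → forget (split (proj₁ e) ℓ i))     ≡⟨ shape-splits (proj₁ e) i ⟩
    splits (shape e)                                  ∎
    where open ≡-Reasoning

  mult-step : (i : ℕ) (t : PlaneTree) (D : List Outcome) →
              mult t (map shape (step i D)) ≡ ∑ (λ e → mult t (splits (shape e))) D
  mult-step i t []      = refl
  mult-step i t (e ∷ D) = begin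
    mult t (map shape (children i e ++ step i D))
      ≡⟨ cong (mult t) (map-++ shape (children i e) (step i D)) ⟩
    mult t (map shape (children i e) ++ map shape (step i D))
      ≡⟨ ∑-++ _ (map shape (children i e)) _ ⟩
    mult t (map shape (children i e)) + mult t (map shape (step i D))
      ≡⟨ cong₂ _+_ (cong (mult t) (children-shapes i e)) (mult-step i t D) ⟩
    mult t (splits (shape e)) + ∑ (λ e → mult t (splits (shape e))) D ∎
    where open ≡-Reasoning

  -- A plane tree t with k internal nodes occurs exactly rankings t times among the
  -- shapes of the outcomes of R_{k+1}: both counts obey the cherry recursion.
  count-shapes : (k : ℕ) (t : PlaneTree) → internals t ≡ k →
                 mult t (map shape (dist (suc k))) ≡ rankings t
  count-shapes zero    leaf       _ = refl
  count-shapes zero    (node l r) ()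
  count-shapes (suc k) leaf       ()
  count-shapes (suc k) (node l r) internals≡ = begin
    mult t (map shape (step (suc k) D))
      ≡⟨ mult-step (suc k) t D ⟩
    ∑ (λ e → mult t (splits (shape e))) D
      ≡⟨ ∑-cong D (λ e → splits-cherries (shape e) t) ⟩
    ∑ (λ e → mult (shape e) (cherries t)) D
      ≡⟨ mult-swap shape D (cherries t) ⟩
    ∑ (λ x → mult x (map shape D)) (cherries t)
      ≡⟨ ∑-cong-All (cherries t)
           (All.map (λ eq → count-shapes k _ (trans eq (suc-injective internals≡)))
                    (cherries-internals-node l r)) ⟩
    ∑ rankings (cherries t)
      ≡⟨ rankings-cherries l r ⟩
    rankings t ∎
    where
    open ≡-Reasoning
    t = node l r
    D = dist (suc k)

  step-wellRanked : (k : ℕ) (D : List Outcome) → All (WellRanked (suc k) ∘ proj₁) D →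
                    All (WellRanked (suc (suc k)) ∘ proj₁) (step (suc k) D)
  step-wellRanked k []      []         = []
  step-wellRanked k (e ∷ D) (wr ∷ wrs) =
    AllP.++⁺ (AllP.map⁺ (AllP.tabulate⁺ (λ ℓ → split-wellRanked k (proj₁ e) ℓ wr)))
             (step-wellRanked k D wrs)

  dist-wellRanked : (k : ℕ) → All (WellRanked (suc k) ∘ proj₁) (dist (suc k))
  dist-wellRanked zero    = ((refl , ↭-refl , tt , tt) , []) ∷ []
  dist-wellRanked (suc k) = step-wellRanked k (dist (suc k)) (dist-wellRanked k)

  Fresh : ℕ → Outcome → Set
  Fresh i e = All (_< i) (labels (proj₁ e))

  children-parent : (i : ℕ) (e : Outcome) → Fresh i e →
                    All (λ v → unsplit i v ≡ proj₁ e) (map proj₁ (children i e))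
  children-parent i e fresh =
    subst (All _) (sym (children-trees i e))
          (AllP.tabulate⁺ (λ ℓ → unsplit-split (proj₁ e) ℓ i fresh))

  children-unique : (i : ℕ) (e : Outcome) → Unique (map proj₁ (children i e))
  children-unique i e =
    subst Unique (sym (children-trees i e)) (UniqueP.tabulate⁺ (split-injective (proj₁ e) i))

  step-parents : (i : ℕ) (D : List Outcome) → All (Fresh i) D →
                 All (λ v → unsplit i v ∈ map proj₁ D) (map proj₁ (step i D))
  step-parents i []      []               = []
  step-parents i (e ∷ D) (fresh ∷ freshs) =
    subst (All _) (sym (map-++ proj₁ (children i e) (step i D)))
      (AllP.++⁺ (All.map here (children-parent i e fresh)) (All.map there (step-parents i D freshs)))

  step-unique : (i : ℕ) (D : List Outcome) → Unique (map proj₁ D) → All (Fresh i) D →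
                Unique (map proj₁ (step i D))
  step-unique i []      []              []               = []
  step-unique i (e ∷ D) (e∉D ∷ uniqueD) (fresh ∷ freshs) =
    subst Unique (sym (map-++ proj₁ (children i e) (step i D)))
      (UniqueP.++⁺ (children-unique i e) (step-unique i D uniqueD freshs) disjoint)
    where
    disjoint : ∀ {v} → ¬ (v ∈ map proj₁ (children i e) × v ∈ map proj₁ (step i D))
    disjoint (v∈children , v∈rest) =
      All.lookup e∉D (subst (_∈ map proj₁ D) (All.lookup (children-parent i e fresh) v∈children)
                            (All.lookup (step-parents i D freshs) v∈rest))
                 refl

  dist-unique : (k : ℕ) → Unique (map proj₁ (dist (suc k)))
  dist-unique zero    = [] ∷ []
  dist-unique (suc k) =
    step-unique (suc k) (dist (suc k)) (dist-unique k) (All.map proj₂ (dist-wellRanked k))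

  weightOf : List Outcome → RTree → Carrier
  weightOf D r = sumS (map proj₂ (filter (λ e → proj₁ e ≟T r) D))

  weightOf-absent : (D : List Outcome) (r : RTree) → All (r ≢_) (map proj₁ D) → weightOf D r ≈ 0#
  weightOf-absent []      r []          = ≈-refl
  weightOf-absent (d ∷ D) r (r≢d ∷ r∉D) with proj₁ d ≟T r
  ... | yes d≡r = ⊥-elim (r≢d (sym d≡r))
  ... | no _    = weightOf-absent D r r∉D

  weightOf-other : (d : Outcome) (D : List Outcome) (r : RTree) → proj₁ d ≢ r →
                   weightOf (d ∷ D) r ≡ weightOf D r
  weightOf-other d D r d≢r with proj₁ d ≟T r
  ... | yes d≡r = ⊥-elim (d≢r d≡r)
  ... | no _    = refl

  weightOf-here : (d : Outcome) (D : List Outcome) → All (proj₁ d ≢_) (map proj₁ D) →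
                  proj₂ d ≈ weightOf (d ∷ D) (proj₁ d)
  weightOf-here d D d∉D with proj₁ d ≟T proj₁ d
  ... | yes _   = ≈-sym (≈-trans (+S-cong ≈-refl (weightOf-absent D (proj₁ d) d∉D))
                                 (+S-identityʳ (proj₂ d)))
  ... | no d≢d  = ⊥-elim (d≢d refl)

  weightOf-unique : (D : List Outcome) → Unique (map proj₁ D) →
                    All (λ e → proj₂ e ≈ weightOf D (proj₁ e)) D
  weightOf-unique []      []              = []
  weightOf-unique (d ∷ D) (d∉D ∷ uniqueD) =
    weightOf-here d D d∉D ∷
    All.zipWith (λ { (e≈ , d≢e) → ≈-trans e≈ (≈-reflexive (sym (weightOf-other d D _ d≢e))) })
                (weightOf-unique D uniqueD , AllP.map⁻ d∉D)

  sumS-const : (f : A → Carrier) (w : Carrier) (xs : List A) → All (λ x → f x ≈ w) xs →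
               sumS (map f xs) ≈ length xs ×ₛ w
  sumS-const f w []       []           = ≈-refl
  sumS-const f w (x ∷ xs) (fx≈w ∷ all) = +S-cong fx≈w (sumS-const f w xs all)

  Exchangeable : ℕ → Set ℓ′
  Exchangeable k = (r r′ : RTree) → IsRanked k r → IsRanked k r′ → forget r ≡ forget r′ →
                   PrR k r ≈ PrR k r′

  ofShape : ℕ → PlaneTree → List Outcome
  ofShape k t = filter (λ e → shape e ≟P t) (dist (suc k))

  ofShape-count : (k : ℕ) (t : PlaneTree) → leaves t ≡ suc k → length (ofShape k t) ≡ catalan t
  ofShape-count k t leaves≡ = begin
    length (ofShape k t)      ≡⟨ length-filter (λ e → shape e ≟P t) (dist (suc k)) ⟩
    ∑ (λ e → δ (shape e) t) (dist (suc k)) ≡⟨ ∑-map _ shape (dist (suc k)) ⟨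
    mult t (map shape (dist (suc k)))
      ≡⟨ count-shapes k t (suc-injective (trans (sym (leaves≡suc-internals t)) leaves≡)) ⟩
    rankings t                ≡⟨ catalan≡rankings t ⟨
    catalan t                 ∎
    where open ≡-Reasoning

  ofShape-weights : (k : ℕ) → Exchangeable (suc k) → (t : PlaneTree) (r : RTree) →
                    IsRanked (suc k) r → forget r ≡ t →
                    All (λ e → proj₂ e ≈ PrR (suc k) r) (ofShape k t)
  ofShape-weights k exchangeable t r ranked r-shape =
    All.zipWith weighs
      ( AllP.filter⁺ (λ e → shape e ≟P t)
                     (All.zip (dist-wellRanked k , weightOf-unique D (dist-unique k)))
      , AllP.all-filter (λ e → shape e ≟P t) D )
    where
    D = dist (suc k)
    weighs : ∀ {e} → (WellRanked (suc k) (proj₁ e) × proj₂ e ≈ PrR (suc k) (proj₁ e)) × shape e ≡ t →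
             proj₂ e ≈ PrR (suc k) r
    weighs {e} ((wellRanked , e≈) , e-shape) =
      ≈-trans e≈ (exchangeable (proj₁ e) r (proj₁ wellRanked) ranked (trans e-shape (sym r-shape)))

mainTheorem5 : {c ℓ : Level} (S : CommutativeSemiring c ℓ)
    (p : (t : PlaneTree) → Fin (leaves t) → CommutativeSemiring.Carrier S) →
    Process.SumsToOne S p →
    (k : ℕ) → k ≥ 1 →
    ((r r′ : RTree) → IsRanked k r → IsRanked k r′ → forget r ≡ forget r′ →
      CommutativeSemiring._≈_ S (Process.PrR S p k r) (Process.PrR S p k r′)) →
    (t : PlaneTree) → leaves t ≡ k →
    (r : RTree) → IsRanked k r → forget r ≡ t →
    CommutativeSemiring._≈_ S (Process.PrT S p k t)
      (Process._×ₛ_ S p (catalan t) (Process.PrR S p k r))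
mainTheorem5 S p _ (suc k) (s≤s z≤n) exchangeable t leaves≡ r ranked r-shape = begin
  PrT (suc k) t
    ≈⟨ sumS-const proj₂ (PrR (suc k) r) (ofShape k t)
                  (ofShape-weights k exchangeable t r ranked r-shape) ⟩
  length (ofShape k t) ×ₛ PrR (suc k) r
    ≡⟨ cong (_×ₛ PrR (suc k) r) (ofShape-count k t leaves≡) ⟩
  catalan t ×ₛ PrR (suc k) r ∎
  where
  open Process S p
  open SplittingProcess S p
  open SetoidReasoning (CommutativeSemiring.setoid S)
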